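{- For every $\phi\in\mathcal{L}_{ELKy^r}$, every $\mathbf{ELKy^r}$-model $\mathfrak{M}$ and every world $w$ of $\mathfrak{M}$: $(\mathfrak{M},w)\models\phi$ if and only if $(\mathfrak{M}^F,w)\models\phi$, where $\mathfrak{M}^F$ is the factive companion of $\mathfrak{M}$.
   Context: Fix a countable set of agents $\mathcal{A}$ and a countably infinite set of atoms $\mathcal{P}$. $\mathcal{L}_{ELKy^r}$: $\phi ::= p\mid\neg\phi\mid(\phi\land\phi)\mid K_a\phi\mid Ky_a^r(\phi,\phi)$. $\Lambda$ is a fixed set of valid formulas (tautology ground). An $\mathbf{ELKy^r}$-model is $\mathfrak{M}=\langle W,E,\{R_a\}_{a\in\mathcal{A}},\mathcal{E},V\rangle$ with $W\neq\emptyset$; $E$ nonempty, containing a designated $e$, closed under a binary operation $\cdot$; $R_a\subseteq W\times W$; $\mathcal{E}:E\times\mathcal{L}_{ELKy^r}\to 2^W$ with $\mathcal{E}(e,\phi)=W$ for $\phi\in\Lambda$ and $\mathcal{E}(s,\phi\to\psi)\cap\mathcal{E}(t,\phi)\subseteq\mathcal{E}(s\cdot t,\psi)$; $V:\mathcal{P}\to 2^W$. Truth: $p,\neg,\land$ as usual; $K_a\phi$ holds at $w$ iff $\phi$ holds at all $R_a$-successors; $Ky_a^r(\phi,\psi)$ holds at $w$ iff there is $t\in E$ such that every $v$ with $(w,v)\in R_a$ and $(\mathfrak{M},v)\models\phi$ satisfies $v\in\mathcal{E}(t,\psi)$ and $(\mathfrak{M},v)\models\psi$. The factive companion $\mathfrak{M}^F$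 is $\mathfrak{M}$ with $\mathcal{E}$ replaced by $\mathcal{E}^F(t,\phi)=\mathcal{E}(t,\phi)\setminus\{w\in W\mid(\mathfrak{M},w)\not\models\phi\}$. -}

module Defs where

open import Data.Nat using (ℕ)
open import Data.Product using (Σ; _×_; _,_)
open import Relation.Nullary using (¬_)

data Form (Ag : Set) : Set where
  atom : ℕ → Form Ag
  ¬'_  : Form Ag → Form Ag
  _∧'_ : Form Ag → Form Ag → Form Ag
  K    : Ag → Form Ag → Form Ag
  Ky   : Ag → Form Ag → Form Ag → Form Ag

_⇒'_ : {Ag : Set} → Form Ag → Form Ag → Form Ag
φ ⇒' ψ = ¬' (φ ∧' (¬' ψ))

-- Structures ⟨W,E,{R_a},ℰ,V⟩ (without the ELKy^r-model conditions); truth only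
-- depends on these components.  Subsets of W are predicates W → Set.
record Structure (Ag : Set) : Set₁ where
  field
    W    : Set
    E    : Set
    e    : E
    _·_  : E → E → E
    R    : Ag → W → W → Set
    Ev   : E → Form Ag → W → Set
    V    : ℕ → W → Set

open Structure public

_,_⊨_ : {Ag : Set} (M : Structure Ag) → W M → Form Ag → Set
M , w ⊨ atom p  = V M p w
M , w ⊨ (¬' φ)  = ¬ (M , w ⊨ φ)
M , w ⊨ (φ ∧' ψ) = (M , w ⊨ φ) × (M , w ⊨ ψ)
M , w ⊨ K a φ   = ∀ v → R M a w v → M , v ⊨ φ
M , w ⊨ Ky a φ ψ = Σ (E M) λ t → ∀ v → R M a w v → M , v ⊨ φ →
                      Ev M t ψ v × (M , v ⊨ ψ)

record IsELKyModel {Ag : Set} (Λ : Form Ag → Set) (M : Structure Ag) : Set where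
  field
    nonemptyW : W M                   -- W ≠ ∅  (E ∋ e is built into Structure)
    Ev-Λ   : ∀ φ → Λ φ → ∀ w → Ev M (e M) φ w
    Ev-app : ∀ s t φ ψ w → Ev M s (φ ⇒' ψ) w → Ev M t φ w → Ev M (_·_ M s t) ψ w

-- factive companion M^F : ℰ^F(t,φ) = ℰ(t,φ) ∖ {w | (M,w) ⊭ φ}
factive : {Ag : Set} → Structure Ag → Structure Ag
factive M = record
  { W = W M ; E = E M ; e = e M ; _·_ = _·_ M ; R = R M
  ; Ev = λ t φ w → Ev M t φ w × ¬ ¬ (M , w ⊨ φ)
  ; V = V M }

module Submission where

open import Defs
open import Data.Nat using (ℕ)
open import Function.Definitions using (Injective)
open import Relation.Binary.PropositionalEquality using (_≡_)
open import Data.Product using (Σ; _×_; _,_)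

-- Evidence is only ever consulted by Ky_a(φ,ψ), and
-- there only at worlds where ψ is additionally required to be true, so the
-- extra factivity condition is automatically met.  Hence the two directions
-- (M ⊨ φ ⇒ M^F ⊨ φ and back) are proved by one simultaneous induction on φ;
-- they must be mutual because negation swaps them.

module _ {Ag : Set} (M : Structure Ag) where

  mutual
    true⇒trueᶠ : (φ : Form Ag) (w : W M) → M , w ⊨ φ → factive M , w ⊨ φ
    true⇒trueᶠ (atom p)   w holds           = holds
    true⇒trueᶠ (¬' φ)     w notφ φᶠ         = notφ (trueᶠ⇒true φ w φᶠ)
    true⇒trueᶠ (φ ∧' ψ)   w (φ-holds , ψ-holds) =
      true⇒trueᶠ φ w φ-holds , true⇒trueᶠ ψ w ψ-holds
    true⇒trueᶠ (K a φ)    w known v wRv     = true⇒trueᶠ φ v (known v wRv)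
    true⇒trueᶠ (Ky a φ ψ) w (t , justified) = t , justifiedᶠ
      where
      -- The evidence t still works in M^F: at each φ-world ψ is true in M,
      -- which is exactly the factivity side condition of ℰ^F(t,ψ).
      justifiedᶠ : ∀ v → R M a w v → factive M , v ⊨ φ →
                   Ev (factive M) t ψ v × (factive M , v ⊨ ψ)
      justifiedᶠ v wRv φᶠ with justified v wRv (trueᶠ⇒true φ v φᶠ)
      ... | evidence , ψ-holds =
        (evidence , λ ψ-fails → ψ-fails ψ-holds) , true⇒trueᶠ ψ v ψ-holds

    trueᶠ⇒true : (φ : Form Ag) (w : W M) → factive M , w ⊨ φ → M , w ⊨ φ
    trueᶠ⇒true (atom p)   w holds           = holds
    trueᶠ⇒true (¬' φ)     w notφᶠ φ-holds   = notφᶠ (true⇒trueᶠ φ w φ-holds)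
    trueᶠ⇒true (φ ∧' ψ)   w (φᶠ , ψᶠ)       = trueᶠ⇒true φ w φᶠ , trueᶠ⇒true ψ w ψᶠ
    trueᶠ⇒true (K a φ)    w knownᶠ v wRv    = trueᶠ⇒true φ v (knownᶠ v wRv)
    trueᶠ⇒true (Ky a φ ψ) w (t , justifiedᶠ) = t , justified
      where
      justified : ∀ v → R M a w v → M , v ⊨ φ → Ev M t ψ v × (M , v ⊨ ψ)
      justified v wRv φ-holds with justifiedᶠ v wRv (true⇒trueᶠ φ v φ-holds)
      ... | (evidence , _) , ψᶠ = evidence , trueᶠ⇒true ψ v ψᶠ

lemma4p3 : (Ag : Set) → Σ (Ag → ℕ) (Injective _≡_ _≡_) →
    (Λ : Form Ag → Set) →
    ((φ : Form Ag) → Λ φ → (M : Structure Ag) → (w : W M) → M , w ⊨ φ) →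
    (φ : Form Ag) (M : Structure Ag) → IsELKyModel Λ M → (w : W M) →
    ((M , w ⊨ φ) → (factive M , w ⊨ φ)) × ((factive M , w ⊨ φ) → (M , w ⊨ φ))
lemma4p3 Ag _ Λ _ φ M _ w = true⇒trueᶠ M φ w , trueᶠ⇒true M φ w
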